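{- Let $\ell\in\mathbb{N}_0$, let $s$ be an $\ell$-square and let $T$ be a compact quadtree configuration. Then $s$ can be assigned to an empty $\ell$-pixel of $T$ (i.e., $T$ has an empty $\ell$-pixel) if and only if $\mathrm{cap}(T) \ge 4^{ -\ell}$.
   Context: The unit square $[0,1]^2$ is recursively subdivided as a quadtree of unbounded depth: the root (layer $0$) is $[0,1]^2$, and every node (pixel) of layer $j$ is an axis-parallel square of side $2^{ -j}$ whose four children are its four quadrants. A pixel of layer $j$ is a $j$-pixel. For $r\in\mathbb{N}_0$, an $r$-square is an axis-parallel square of side $2^{ -r}$. A (quadtree) configuration assigns finitely many squares to pixels, each $j$-square to a $j$-pixel, at most one square per pixel, such that no pixel with an assigned square is a proper descendant of another pixel with an assigned square. A pixel contains a square if it is assigned to it or to a descendant. A pixel with an assigned square is occupied; a non-occupied pixel is blocked if some ancestor is occupied, free otherwise; a free pixel is fractional if it contains a square and empty if it contains no square; an empty pixel is maximally empty if its parent is not empty (an empty root counts as maximally empty). The capacity $\mathrm{cap}(p)$ of a $j$-pixel $p$ is $0$ if $p$ is occupied or blocked, $4^{ -j}$ if $p$ is empty, and otherwise the sum of the capacities of its four children; $\mathrm{cap}(T)$ is the capacity of the root. A fractional pixel is open if at least one of its children is (maximally) empty. A configuration is compact if for every $j\in\mathbb{N}_0$ there is at most one open $j$-pixel. -}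

module Defs where

open import Data.Nat using (ℕ; zero; suc)
open import Data.Bool using (Bool; true; false; _∨_)
open import Data.Fin using (Fin; zero; suc)
open import Data.List using (List; []; _∷_; _++_; length; [_])
open import Data.Product using (Σ; _×_)
open import Data.Integer using (+_)
open import Data.Rational using (ℚ; 0ℚ; 1ℚ; _+_; _*_; _/_)
open import Relation.Binary.PropositionalEquality using (_≡_)

-- A quadtree configuration, encoded as a finite quadtree:
--   sq        : this pixel has an assigned square (it is occupied;
--               all its proper descendants are blocked),
--   nosq      : no square is assigned to this pixel or any descendant,
--   split a b c d : no square assigned to this pixel; its four quadrants
--               (children 0,1,2,3) are described by a b c d.
-- Every configuration (finite antichain of occupied pixels) is encoded
-- by such a tree (finite, so finitely many squares; antichain by
-- construction). A 'split' node containing no 'sq' is semantically the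
-- same as 'nosq' (all definitions below are semantic).
data Config : Set where
  sq   : Config
  nosq : Config
  split : Config → Config → Config → Config → Config

child : Config → Config → Config → Config → Fin 4 → Config
child a b c d zero = a
child a b c d (suc zero) = b
child a b c d (suc (suc zero)) = c
child a b c d (suc (suc (suc zero))) = d

containsSq : Config → Bool
containsSq sq = true
containsSq nosq = false
containsSq (split a b c d) =
  containsSq a ∨ containsSq b ∨ containsSq c ∨ containsSq d

-- A pixel is a path from the root; its layer is its length.
Pixel : Set
Pixel = List (Fin 4)

data Status : Set where
  occupied blocked empty fractional : Status

status : Config → Pixel → Status
status sq [] = occupied
status sq (_ ∷ _) = blocked
status nosq _ = empty
status (split a b c d) [] with containsSq (split a b c d)
... | true = fractional
... | false = empty
status (split a b c d) (i ∷ p) = status (child a b c d i) p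

quarterPow : ℕ → ℚ
quarterPow zero = 1ℚ
quarterPow (suc j) = (+ 1 / 4) * quarterPow j

capAt : ℕ → Config → ℚ
capAt j sq = 0ℚ
capAt j nosq = quarterPow j
capAt j (split a b c d) with containsSq (split a b c d)
... | false = quarterPow j
... | true = capAt (suc j) a + capAt (suc j) b + capAt (suc j) c + capAt (suc j) d

cap : Config → ℚ
cap T = capAt 0 T

Open : Config → Pixel → Set
Open T p = (status T p ≡ fractional) × Σ (Fin 4) (λ i → status T (p ++ [ i ]) ≡ empty)

Compact : Config → Set
Compact T = ∀ (p q : Pixel) → length p ≡ length q → Open T p → Open T q → p ≡ q

module Submission where

-- Let E(n) and M(n) count the empty and the maximally empty n-pixels of T.
-- An empty (n+1)-pixel is a child of an empty n-pixel or maximally empty, so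
-- E(n+1) = 4·E(n) + M(n+1). A maximally empty (n+1)-pixel is a child of an
-- open n-pixel; compactness leaves one such pixel, which being fractional has
-- at most 3 empty children, so M(n+1) ≤ 3. Hence 4^m·E(ℓ) ≤ E(m+ℓ) <
-- 4^m·(E(ℓ)+1), i.e. E(ℓ) ≥ 1 iff E(m+ℓ) ≥ 4^m. Beyond the depth of the tree
-- cap(T) = E(n)·4^{-n}, so for n = depth T + ℓ the inequality 4^{-ℓ} ≤ cap(T)
-- reads 4^{depth T} ≤ E(n).

open import Defs
open import Data.Nat using (ℕ)
open import Data.List using (length)
open import Data.Product using (Σ; _×_)
open import Data.Rational using (_≤_)
open import Relation.Binary.PropositionalEquality using (_≡_)
open import Function.Bundles using (_⇔_)

open import Algebra.Bundles using (CommutativeRing)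
open import Data.Bool using (Bool; true; false; _∨_)
open import Data.Bool.Properties using (∨-conicalˡ; ∨-conicalʳ)
open import Data.Empty using (⊥; ⊥-elim)
open import Data.Fin using (Fin)
open import Data.Fin.Patterns using (0F; 1F; 2F; 3F)
open import Data.List using ([]; _∷_; replicate)
import Data.List.Properties as List
open import Data.Nat as ℕ using (zero; suc; _+_; _*_; _^_; _⊔_; z≤n; s≤s)
import Data.Nat.Properties as ℕ
open import Data.Nat.Tactic.RingSolver using (solve-∀)
open import Data.Product using (_,_)
open import Data.Sum using (_⊎_; inj₁; inj₂)
open import Data.Integer using (+_)
open import Data.Rational as ℚ using (ℚ; 0ℚ; 1ℚ; Positive)
import Data.Rational.Properties as ℚ
import Function.Properties.Equivalence as ⇔
open import Function.Bundles using (mk⇔)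
open import Relation.Binary.PropositionalEquality
  using (refl; sym; trans; cong; cong₂; subst; subst₂; module ≡-Reasoning)
open import Relation.Nullary using (¬_; yes; no)

open import Algebra.Properties.Semiring.Mult (CommutativeRing.semiring ℚ.+-*-commutativeRing)
  using (×-homo-+; ×1-homo-*) renaming (_×_ to _·_)
open import Algebra.Properties.CommutativeSemigroup
  (CommutativeRing.*-commutativeSemigroup ℚ.+-*-commutativeRing) using (interchange)

forEachChild : (P : Config → Set) {a b c d : Config} →
  P a → P b → P c → P d → ∀ i → P (child a b c d i)
forEachChild P pa pb pc pd 0F = pa
forEachChild P pa pb pc pd 1F = pb
forEachChild P pa pb pc pd 2F = pc
forEachChild P pa pb pc pd 3F = pd

square-free-children : ∀ a b c d → containsSq (split a b c d) ≡ false →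
  ∀ i → containsSq (child a b c d i) ≡ false
square-free-children a b c d h = forEachChild (λ X → containsSq X ≡ false)
  (∨-conicalˡ ca _ h)
  (∨-conicalˡ cb _ (∨-conicalʳ ca _ h))
  (∨-conicalˡ cc _ (∨-conicalʳ cb _ (∨-conicalʳ ca _ h)))
  (∨-conicalʳ cc _ (∨-conicalʳ cb _ (∨-conicalʳ ca _ h)))
  where
  ca cb cc : Bool
  ca = containsSq a
  cb = containsSq b
  cc = containsSq c

square-free⇒empty : ∀ T p → containsSq T ≡ false → status T p ≡ empty
square-free⇒empty sq p ()
square-free⇒empty nosq p _ = refl
square-free⇒empty (split a b c d) [] h with containsSq (split a b c d)
square-free⇒empty (split a b c d) [] refl | false = refl
square-free⇒empty (split a b c d) (i ∷ p) h =
  square-free⇒empty (child a b c d i) p (square-free-children a b c d h i)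

split-fractional : ∀ a b c d → containsSq (split a b c d) ≡ true →
  status (split a b c d) [] ≡ fractional
split-fractional a b c d h with containsSq (split a b c d)
split-fractional a b c d refl | true = refl

-- Compactness passes to subtrees: open pixels of a child are open pixels of
-- the parent one layer deeper, and distinct ones stay distinct.
compact-child : ∀ a b c d → Compact (split a b c d) → ∀ i → Compact (child a b c d i)
compact-child a b c d compact i p q same-layer op oq =
  List.∷-injectiveʳ (compact (i ∷ p) (i ∷ q) (cong suc same-layer) op oq)

sum4 : (Fin 4 → ℕ) → ℕ
sum4 x = x 0F + x 1F + x 2F + x 3F

positive-summand : ∀ m n → 0 ℕ.< m + n → 0 ℕ.< m ⊎ 0 ℕ.< n
positive-summand zero n h = inj₂ h
positive-summand (suc m) n _ = inj₁ ℕ.0<1+n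

positive-entry : ∀ x → 0 ℕ.< sum4 x → Σ (Fin 4) (λ i → 0 ℕ.< x i)
positive-entry x h with positive-summand (x 0F + x 1F + x 2F) (x 3F) h
... | inj₂ h₃ = 3F , h₃
... | inj₁ h₀₁₂ with positive-summand (x 0F + x 1F) (x 2F) h₀₁₂
... | inj₂ h₂ = 2F , h₂
... | inj₁ h₀₁ with positive-summand (x 0F) (x 1F) h₀₁
... | inj₁ h₀ = 0F , h₀
... | inj₂ h₁ = 1F , h₁

entry-≤-sum4 : ∀ x i → x i ℕ.≤ sum4 x
entry-≤-sum4 x 0F =
  ℕ.≤-trans (ℕ.m≤m+n (x 0F) _) (ℕ.≤-trans (ℕ.m≤m+n _ (x 2F)) (ℕ.m≤m+n _ (x 3F)))
entry-≤-sum4 x 1F =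
  ℕ.≤-trans (ℕ.m≤n+m (x 1F) _) (ℕ.≤-trans (ℕ.m≤m+n _ (x 2F)) (ℕ.m≤m+n _ (x 3F)))
entry-≤-sum4 x 2F = ℕ.≤-trans (ℕ.m≤n+m (x 2F) _) (ℕ.m≤m+n _ (x 3F))
entry-≤-sum4 x 3F = ℕ.m≤n+m (x 3F) _

Apart : ℕ → ℕ → Set
Apart m n = 0 ℕ.< m → 0 ℕ.< n → ⊥

apart-+ : ∀ {m n o} → Apart m o → Apart n o → Apart (m + n) o
apart-+ {m} {n} m∥o n∥o pos with positive-summand m n pos
... | inj₁ m>0 = m∥o m>0
... | inj₂ n>0 = n∥o n>0

-- The sum of two apart numbers is one of them, so it keeps a common bound.
+-≤-apart : ∀ {m n k} → m ℕ.≤ k → n ℕ.≤ k → Apart m n → m + n ℕ.≤ k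
+-≤-apart {zero} m≤k n≤k _ = n≤k
+-≤-apart {suc m} {zero} m≤k n≤k _ = ℕ.≤-trans (ℕ.≤-reflexive (ℕ.+-identityʳ (suc m))) m≤k
+-≤-apart {suc m} {suc n} m≤k n≤k m∥n = ⊥-elim (m∥n ℕ.0<1+n ℕ.0<1+n)

sum4-≤-single : ∀ {k} x → (∀ i → x i ℕ.≤ k) →
  (∀ i j → 0 ℕ.< x i → 0 ℕ.< x j → i ≡ j) → sum4 x ℕ.≤ k
sum4-≤-single x bound single =
  +-≤-apart (+-≤-apart (+-≤-apart (bound 0F) (bound 1F) (apart 0F 1F (λ ())))
                       (bound 2F) (apart-+ (apart 0F 2F (λ ())) (apart 1F 2F (λ ()))))
            (bound 3F)
            (apart-+ (apart-+ (apart 0F 3F (λ ())) (apart 1F 3F (λ ()))) (apart 2F 3F (λ ())))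
  where
  apart : ∀ i j → ¬ i ≡ j → Apart (x i) (x j)
  apart i j i≢j xi>0 xj>0 = i≢j (single i j xi>0 xj>0)

absent : Bool → ℕ
absent true = 0
absent false = 1

absent-positive : ∀ {x} → 0 ℕ.< absent x → x ≡ false
absent-positive {false} _ = refl

absent-≤1 : ∀ x → absent x ℕ.≤ 1
absent-≤1 true = z≤n
absent-≤1 false = ℕ.≤-refl

absent-sum-≤3 : ∀ x y z w → x ∨ y ∨ z ∨ w ≡ true →
  absent x + absent y + absent z + absent w ℕ.≤ 3
absent-sum-≤3 false false false false ()
absent-sum-≤3 true y z w _ = ℕ.+-mono-≤ (ℕ.+-mono-≤ (absent-≤1 y) (absent-≤1 z)) (absent-≤1 w)
absent-sum-≤3 false true z w _ = s≤s (ℕ.+-mono-≤ (absent-≤1 z) (absent-≤1 w))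
absent-sum-≤3 false false true w _ = s≤s (s≤s (absent-≤1 w))
absent-sum-≤3 false false false true _ = s≤s (s≤s (s≤s z≤n))

emptyCount : ℕ → Config → ℕ
emptyCount n sq = 0
emptyCount n nosq = 4 ^ n
emptyCount n (split a b c d) with containsSq (split a b c d)
... | false = 4 ^ n
emptyCount zero (split a b c d) | true = 0
emptyCount (suc n) (split a b c d) | true =
  emptyCount n a + emptyCount n b + emptyCount n c + emptyCount n d

maxEmptyCount : ℕ → Config → ℕ
maxEmptyCount zero T = absent (containsSq T)
maxEmptyCount (suc n) sq = 0
maxEmptyCount (suc n) nosq = 0
maxEmptyCount (suc n) (split a b c d) with containsSq (split a b c d)
... | false = 0
... | true = maxEmptyCount n a + maxEmptyCount n b + maxEmptyCount n c + maxEmptyCount n d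

-- The root is the only 0-pixel; if empty, it is maximally empty.
emptyCount-zero : ∀ T → emptyCount 0 T ≡ maxEmptyCount 0 T
emptyCount-zero sq = refl
emptyCount-zero nosq = refl
emptyCount-zero (split a b c d) with containsSq (split a b c d)
... | true = refl
... | false = refl

regroup : ∀ x₁ x₂ x₃ x₄ y₁ y₂ y₃ y₄ →
  (4 * x₁ + y₁) + (4 * x₂ + y₂) + (4 * x₃ + y₃) + (4 * x₄ + y₄)
    ≡ 4 * (x₁ + x₂ + x₃ + x₄) + (y₁ + y₂ + y₃ + y₄)
regroup = solve-∀

-- An empty (n+1)-pixel is a child of an empty n-pixel or maximally empty.
emptyCount-suc : ∀ n T → emptyCount (suc n) T ≡ 4 * emptyCount n T + maxEmptyCount (suc n) T
emptyCount-suc n sq = refl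
emptyCount-suc n nosq = sym (ℕ.+-identityʳ _)
emptyCount-suc n (split a b c d) with containsSq (split a b c d)
... | false = sym (ℕ.+-identityʳ _)
emptyCount-suc zero (split a b c d) | true =
  cong₂ _+_ (cong₂ _+_ (cong₂ _+_ (emptyCount-zero a) (emptyCount-zero b)) (emptyCount-zero c))
            (emptyCount-zero d)
emptyCount-suc (suc n) (split a b c d) | true =
  trans (cong₂ _+_ (cong₂ _+_ (cong₂ _+_ (emptyCount-suc n a) (emptyCount-suc n b))
                              (emptyCount-suc n c))
                   (emptyCount-suc n d))
        (regroup (emptyCount n a) (emptyCount n b) (emptyCount n c) (emptyCount n d)
                 (maxEmptyCount (suc n) a) (maxEmptyCount (suc n) b)
                 (maxEmptyCount (suc n) c) (maxEmptyCount (suc n) d))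

corner : ℕ → Pixel
corner n = replicate n 0F

positive⇒empty-pixel : ∀ n T → 0 ℕ.< emptyCount n T →
  Σ Pixel (λ p → (length p ≡ n) × (status T p ≡ empty))
positive⇒empty-pixel n sq ()
positive⇒empty-pixel n nosq _ = corner n , List.length-replicate n , refl
positive⇒empty-pixel n (split a b c d) h with containsSq (split a b c d) in hasSq
... | false = corner n , List.length-replicate n , square-free⇒empty (split a b c d) (corner n) hasSq
positive⇒empty-pixel zero (split a b c d) () | true
positive⇒empty-pixel (suc n) (split a b c d) h | true
  with positive-entry (λ i → emptyCount n (child a b c d i)) h
... | i , hi with forEachChild (λ X → 0 ℕ.< emptyCount n X → Σ Pixel (λ p → (length p ≡ n) × (status X p ≡ empty)))
                   (positive⇒empty-pixel n a) (positive⇒empty-pixel n b)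
                   (positive⇒empty-pixel n c) (positive⇒empty-pixel n d) i hi
... | p , lp , st = i ∷ p , cong suc lp , st

empty-pixel⇒positive : ∀ T p → status T p ≡ empty → 0 ℕ.< emptyCount (length p) T
empty-pixel⇒positive sq [] ()
empty-pixel⇒positive sq (_ ∷ _) ()
empty-pixel⇒positive nosq p _ = ℕ.m^n>0 4 (length p)
empty-pixel⇒positive (split a b c d) p h with containsSq (split a b c d) in hasSq
... | false = ℕ.m^n>0 4 (length p)
empty-pixel⇒positive (split a b c d) [] h | true with trans (sym (split-fractional a b c d hasSq)) h
... | ()
empty-pixel⇒positive (split a b c d) (i ∷ p) h | true =
  ℕ.≤-trans (forEachChild (λ X → status X p ≡ empty → 0 ℕ.< emptyCount (length p) X)
               (empty-pixel⇒positive a p) (empty-pixel⇒positive b p)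
               (empty-pixel⇒positive c p) (empty-pixel⇒positive d p) i h)
            (entry-≤-sum4 (λ j → emptyCount (length p) (child a b c d j)) i)

-- Each empty pixel has four empty children.
emptyCount-growth : ∀ ℓ m T → 4 ^ m * emptyCount ℓ T ℕ.≤ emptyCount (m + ℓ) T
emptyCount-growth ℓ zero T = ℕ.≤-reflexive (ℕ.*-identityˡ _)
emptyCount-growth ℓ (suc m) T = begin
  4 ^ suc m * emptyCount ℓ T          ≡⟨ ℕ.*-assoc 4 (4 ^ m) _ ⟩
  4 * (4 ^ m * emptyCount ℓ T)        ≤⟨ ℕ.*-monoʳ-≤ 4 (emptyCount-growth ℓ m T) ⟩
  4 * emptyCount (m + ℓ) T            ≤⟨ ℕ.m≤m+n _ _ ⟩
  4 * emptyCount (m + ℓ) T + maxEmptyCount (suc (m + ℓ)) T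
                                      ≡⟨ sym (emptyCount-suc (m + ℓ) T) ⟩
  emptyCount (suc m + ℓ) T            ∎
  where open ℕ.≤-Reasoning

maxEmpty⇒open : ∀ k T → 0 ℕ.< maxEmptyCount (suc k) T →
  Σ Pixel (λ p → (length p ≡ k) × Open T p)
maxEmpty⇒open k sq ()
maxEmpty⇒open k nosq ()
maxEmpty⇒open k (split a b c d) h with containsSq (split a b c d) in hasSq
maxEmpty⇒open k (split a b c d) () | false
maxEmpty⇒open zero (split a b c d) h | true
  with positive-entry (λ i → maxEmptyCount 0 (child a b c d i)) h
... | i , hi = [] , refl , split-fractional a b c d hasSq , i ,
               square-free⇒empty (child a b c d i) [] (absent-positive hi)
maxEmpty⇒open (suc k) (split a b c d) h | true
  with positive-entry (λ i → maxEmptyCount (suc k) (child a b c d i)) h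
... | i , hi with forEachChild (λ X → 0 ℕ.< maxEmptyCount (suc k) X → Σ Pixel (λ p → (length p ≡ k) × Open X p))
                   (maxEmpty⇒open k a) (maxEmpty⇒open k b)
                   (maxEmpty⇒open k c) (maxEmpty⇒open k d) i hi
... | p , lp , op = i ∷ p , cong suc lp , op

-- In a compact configuration every layer k+1 has at most three maximally
-- empty pixels: they are the empty children of the unique open k-pixel.
maxEmptyCount-≤3 : ∀ k T → Compact T → maxEmptyCount (suc k) T ℕ.≤ 3
maxEmptyCount-≤3 k sq _ = z≤n
maxEmptyCount-≤3 k nosq _ = z≤n
maxEmptyCount-≤3 k (split a b c d) compact with containsSq (split a b c d) in hasSq
... | false = z≤n
maxEmptyCount-≤3 zero (split a b c d) compact | true =
  absent-sum-≤3 (containsSq a) (containsSq b) (containsSq c) (containsSq d) hasSq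
maxEmptyCount-≤3 (suc k) (split a b c d) compact | true =
  sum4-≤-single (λ i → maxEmptyCount (suc k) (child a b c d i)) bound single
  where
  bound : ∀ i → maxEmptyCount (suc k) (child a b c d i) ℕ.≤ 3
  bound i = forEachChild (λ X → Compact X → maxEmptyCount (suc k) X ℕ.≤ 3)
              (maxEmptyCount-≤3 k a) (maxEmptyCount-≤3 k b)
              (maxEmptyCount-≤3 k c) (maxEmptyCount-≤3 k d) i (compact-child a b c d compact i)
  -- two children with maximally empty pixels would carry two open pixels of
  -- the same layer
  single : ∀ i j → 0 ℕ.< maxEmptyCount (suc k) (child a b c d i) →
    0 ℕ.< maxEmptyCount (suc k) (child a b c d j) → i ≡ j
  single i j hi hj with maxEmpty⇒open k (child a b c d i) hi | maxEmpty⇒open k (child a b c d j) hj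
  ... | p , lp , op | q , lq , oq =
    List.∷-injectiveˡ (compact (i ∷ p) (j ∷ q) (cong suc (trans lp (sym lq))) op oq)

four-suc : ∀ x → suc (4 * x + 3) ≡ 4 * suc x
four-suc = solve-∀

-- In a compact configuration the empty pixels grow by a factor of at most 4
-- per layer up to an additive 3, so E(m+ℓ) < 4^m·(E(ℓ)+1).
emptyCount-bounded-growth : ∀ ℓ m T → Compact T →
  emptyCount (m + ℓ) T ℕ.< 4 ^ m * suc (emptyCount ℓ T)
emptyCount-bounded-growth ℓ zero T _ = ℕ.≤-reflexive (sym (ℕ.*-identityˡ _))
emptyCount-bounded-growth ℓ (suc m) T compact = begin
  suc (emptyCount (suc n) T)                       ≡⟨ cong suc (emptyCount-suc n T) ⟩
  suc (4 * emptyCount n T + maxEmptyCount (suc n) T)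
                                                   ≤⟨ s≤s (ℕ.+-monoʳ-≤ _ (maxEmptyCount-≤3 n T compact)) ⟩
  suc (4 * emptyCount n T + 3)                     ≡⟨ four-suc (emptyCount n T) ⟩
  4 * suc (emptyCount n T)                         ≤⟨ ℕ.*-monoʳ-≤ 4 (emptyCount-bounded-growth ℓ m T compact) ⟩
  4 * (4 ^ m * suc (emptyCount ℓ T))               ≡⟨ sym (ℕ.*-assoc 4 (4 ^ m) _) ⟩
  4 ^ suc m * suc (emptyCount ℓ T)                 ∎
  where
  n : ℕ
  n = m + ℓ
  open ℕ.≤-Reasoning

empty-pixel⇔count : ∀ ℓ m T → Compact T →
  Σ Pixel (λ p → (length p ≡ ℓ) × (status T p ≡ empty)) ⇔ (4 ^ m ℕ.≤ emptyCount (m + ℓ) T)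
empty-pixel⇔count ℓ m T compact = mk⇔ to from
  where
  to : Σ Pixel (λ p → (length p ≡ ℓ) × (status T p ≡ empty)) → 4 ^ m ℕ.≤ emptyCount (m + ℓ) T
  to (p , refl , st) = begin
    4 ^ m                               ≡⟨ sym (ℕ.*-identityʳ (4 ^ m)) ⟩
    4 ^ m * 1                           ≤⟨ ℕ.*-monoʳ-≤ (4 ^ m) (empty-pixel⇒positive T p st) ⟩
    4 ^ m * emptyCount (length p) T     ≤⟨ emptyCount-growth (length p) m T ⟩
    emptyCount (m + length p) T         ∎
    where open ℕ.≤-Reasoning
  from : 4 ^ m ℕ.≤ emptyCount (m + ℓ) T → Σ Pixel (λ p → (length p ≡ ℓ) × (status T p ≡ empty))
  from many = positive⇒empty-pixel ℓ T (ℕ.n≢0⇒n>0 none-missing)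
    where
    -- without empty ℓ-pixels there are fewer than 4^m empty (m+ℓ)-pixels
    none-missing : ¬ emptyCount ℓ T ≡ 0
    none-missing none = ℕ.≤⇒≯ many (subst (emptyCount (m + ℓ) T ℕ.<_) (ℕ.*-identityʳ (4 ^ m))
      (subst (λ k → emptyCount (m + ℓ) T ℕ.< 4 ^ m * suc k) none (emptyCount-bounded-growth ℓ m T compact)))

toℚ : ℕ → ℚ
toℚ n = n · 1ℚ

toℚ-nonNeg : ∀ n → 0ℚ ℚ.≤ toℚ n
toℚ-nonNeg zero = ℚ.≤-refl
toℚ-nonNeg (suc n) = ℚ.+-mono-≤ (ℚ.<⇒≤ (ℚ.positive⁻¹ 1ℚ)) (toℚ-nonNeg n)

toℚ-mono : ∀ {m n} → m ℕ.≤ n → toℚ m ℚ.≤ toℚ n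
toℚ-mono {n = n} z≤n = toℚ-nonNeg n
toℚ-mono (s≤s m≤n) = ℚ.+-monoʳ-≤ 1ℚ (toℚ-mono m≤n)

toℚ-strict : ∀ {m n} → m ℕ.< n → toℚ m ℚ.< toℚ n
toℚ-strict {m} {suc n} (s≤s m≤n) = ℚ.≤-<-trans (toℚ-mono m≤n)
  (subst (ℚ._< 1ℚ ℚ.+ toℚ n) (ℚ.+-identityˡ (toℚ n))
    (ℚ.+-mono-<-≤ (ℚ.positive⁻¹ 1ℚ) (ℚ.≤-refl {toℚ n})))

toℚ-cancel-≤ : ∀ {m n} → toℚ m ℚ.≤ toℚ n → m ℕ.≤ n
toℚ-cancel-≤ {m} {n} h with m ℕ.≤? n
... | yes m≤n = m≤n
... | no m≰n =
  ⊥-elim (ℚ.<-irrefl refl (ℚ.<-≤-trans (toℚ-strict (ℕ.≰⇒> m≰n)) h))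

toℚ-scaled-≤ : ∀ q .{{_ : Positive q}} m n → (toℚ m ℚ.* q ≤ toℚ n ℚ.* q) ⇔ (m ℕ.≤ n)
toℚ-scaled-≤ q m n = mk⇔ (λ h → toℚ-cancel-≤ (ℚ.*-cancelʳ-≤-pos q h))
                         (λ h → ℚ.*-monoʳ-≤-nonNeg q {{ℚ.pos⇒nonNeg q}} (toℚ-mono h))

¼ : ℚ
¼ = + 1 ℚ./ 4

quarterPow-positive : ∀ j → Positive (quarterPow j)
quarterPow-positive zero = _
quarterPow-positive (suc j) = ℚ.pos*pos⇒pos ¼ (quarterPow j) {{quarterPow-positive j}}

four-quarters : toℚ 4 ℚ.* ¼ ≡ 1ℚ
four-quarters = refl

quarterPow-scale : ∀ j m → quarterPow j ≡ toℚ (4 ^ m) ℚ.* quarterPow (m + j)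
quarterPow-scale j zero = sym (ℚ.*-identityˡ (quarterPow j))
quarterPow-scale j (suc m) = begin
  quarterPow j                                               ≡⟨ quarterPow-scale j m ⟩
  toℚ (4 ^ m) ℚ.* quarterPow (m + j)                         ≡⟨ sym (ℚ.*-identityˡ rest) ⟩
  1ℚ ℚ.* (toℚ (4 ^ m) ℚ.* quarterPow (m + j))                ≡⟨ cong (ℚ._* rest) (sym four-quarters) ⟩
  (toℚ 4 ℚ.* ¼) ℚ.* (toℚ (4 ^ m) ℚ.* quarterPow (m + j))     ≡⟨ interchange (toℚ 4) ¼ (toℚ (4 ^ m)) (quarterPow (m + j)) ⟩
  (toℚ 4 ℚ.* toℚ (4 ^ m)) ℚ.* (¼ ℚ.* quarterPow (m + j))     ≡⟨ cong (ℚ._* (¼ ℚ.* quarterPow (m + j))) (sym (×1-homo-* 4 (4 ^ m))) ⟩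
  toℚ (4 ^ suc m) ℚ.* quarterPow (suc m + j)                 ∎
  where
  open ≡-Reasoning
  rest : ℚ
  rest = toℚ (4 ^ m) ℚ.* quarterPow (m + j)

toℚ-+-scaled : ∀ m n q → toℚ m ℚ.* q ℚ.+ toℚ n ℚ.* q ≡ toℚ (m + n) ℚ.* q
toℚ-+-scaled m n q =
  trans (sym (ℚ.*-distribʳ-+ q (toℚ m) (toℚ n))) (cong (ℚ._* q) (sym (×-homo-+ 1ℚ m n)))

depth : Config → ℕ
depth sq = 0
depth nosq = 0
depth (split a b c d) = suc (depth a ⊔ depth b ⊔ depth c ⊔ depth d)

depth-children : ∀ {n} a b c d → depth (split a b c d) ℕ.≤ suc n →
  ∀ i → depth (child a b c d i) ℕ.≤ n
depth-children {n} a b c d (s≤s h) = forEachChild (λ X → depth X ℕ.≤ n)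
  (ℕ.m⊔n≤o⇒m≤o (depth a) (depth b) (ℕ.m⊔n≤o⇒m≤o (da ⊔ db) (depth c) abc≤n))
  (ℕ.m⊔n≤o⇒n≤o (depth a) (depth b) (ℕ.m⊔n≤o⇒m≤o (da ⊔ db) (depth c) abc≤n))
  (ℕ.m⊔n≤o⇒n≤o (da ⊔ db) (depth c) abc≤n)
  (ℕ.m⊔n≤o⇒n≤o (da ⊔ db ⊔ depth c) (depth d) h)
  where
  da db : ℕ
  da = depth a
  db = depth b
  abc≤n : da ⊔ db ⊔ depth c ℕ.≤ n
  abc≤n = ℕ.m⊔n≤o⇒m≤o (da ⊔ db ⊔ depth c) (depth d) h

capAt-count : ∀ j n T → depth T ℕ.≤ n → capAt j T ≡ toℚ (emptyCount n T) ℚ.* quarterPow (n + j)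
capAt-count j n sq _ = sym (ℚ.*-zeroˡ (quarterPow (n + j)))
capAt-count j n nosq _ = quarterPow-scale j n
capAt-count j n (split a b c d) h with containsSq (split a b c d)
... | false = quarterPow-scale j n
capAt-count j zero (split a b c d) () | true
capAt-count j (suc n) (split a b c d) h | true = begin
  capAt (suc j) a ℚ.+ capAt (suc j) b ℚ.+ capAt (suc j) c ℚ.+ capAt (suc j) d
    ≡⟨ cong₂ ℚ._+_ (cong₂ ℚ._+_ (cong₂ ℚ._+_ (count 0F) (count 1F)) (count 2F)) (count 3F) ⟩
  E a ℚ.* q ℚ.+ E b ℚ.* q ℚ.+ E c ℚ.* q ℚ.+ E d ℚ.* q
    ≡⟨ cong (λ x → x ℚ.+ E c ℚ.* q ℚ.+ E d ℚ.* q) (toℚ-+-scaled (emptyCount n a) (emptyCount n b) q) ⟩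
  toℚ (emptyCount n a + emptyCount n b) ℚ.* q ℚ.+ E c ℚ.* q ℚ.+ E d ℚ.* q
    ≡⟨ cong (ℚ._+ E d ℚ.* q) (toℚ-+-scaled (emptyCount n a + emptyCount n b) (emptyCount n c) q) ⟩
  toℚ (emptyCount n a + emptyCount n b + emptyCount n c) ℚ.* q ℚ.+ E d ℚ.* q
    ≡⟨ toℚ-+-scaled (emptyCount n a + emptyCount n b + emptyCount n c) (emptyCount n d) q ⟩
  toℚ total ℚ.* q
    ≡⟨ cong (λ k → toℚ total ℚ.* quarterPow k) (ℕ.+-suc n j) ⟩
  toℚ total ℚ.* quarterPow (suc n + j) ∎
  where
  open ≡-Reasoning
  q : ℚ
  q = quarterPow (n + suc j)
  E : Config → ℚ
  E X = toℚ (emptyCount n X)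
  total : ℕ
  total = emptyCount n a + emptyCount n b + emptyCount n c + emptyCount n d
  count : ∀ i → capAt (suc j) (child a b c d i) ≡ E (child a b c d i) ℚ.* q
  count i = forEachChild (λ X → depth X ℕ.≤ n → capAt (suc j) X ≡ E X ℚ.* q)
              (capAt-count (suc j) n a) (capAt-count (suc j) n b)
              (capAt-count (suc j) n c) (capAt-count (suc j) n d) i (depth-children a b c d h i)

cap-count : ∀ n T → depth T ℕ.≤ n → cap T ≡ toℚ (emptyCount n T) ℚ.* quarterPow n
cap-count n T h = trans (capAt-count 0 n T h)
  (cong (λ k → toℚ (emptyCount n T) ℚ.* quarterPow k) (ℕ.+-identityʳ n))

lemma6 : (ℓ : ℕ) (T : Config) → Compact T →
    (Σ Pixel (λ p → (length p ≡ ℓ) × (status T p ≡ empty))) ⇔ (quarterPow ℓ ≤ cap T)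
lemma6 ℓ T compact =
  ⇔.trans (empty-pixel⇔count ℓ m T compact)
  (⇔.trans (⇔.sym (toℚ-scaled-≤ (quarterPow N) {{quarterPow-positive N}} (4 ^ m) (emptyCount N T)))
           rescale)
  where
  m N : ℕ
  m = depth T
  N = m + ℓ
  -- 4^{-ℓ} ≤ cap T, with both sides written in units of 4^{-N}
  Scaled : Set
  Scaled = toℚ (4 ^ m) ℚ.* quarterPow N ≤ toℚ (emptyCount N T) ℚ.* quarterPow N
  rescale : Scaled ⇔ (quarterPow ℓ ≤ cap T)
  rescale = subst₂ (λ x y → Scaled ⇔ (x ≤ y))
                   (sym (quarterPow-scale ℓ m)) (sym (cap-count N T (ℕ.m≤m+n m ℓ))) ⇔.refl
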